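{- For any Dyck path $d$, the polynomial $C_d(t)$ has no internal zeros: there do not exist $0\le i<j<k$ with $[t^i]C_d(t)\ne 0$, $[t^k]C_d(t)\ne 0$ and $[t^j]C_d(t)=0$.
   Context: A Dyck path of semilength $n$ is a lattice path from $(0,0)$ to $(2n,0)$ with steps $U=(1,1)$ and $D=(1,-1)$ never going below the $x$-axis. For $\sigma=\sigma_1\cdots\sigma_n\in\mathfrak{S}_n$, $\mathrm{can}(d,\sigma)$ is the word of length $2n$ obtained by labeling the $i$-th up-step and the $i$-th down-step of $d$ with $\sigma_i$ and reading left to right; $\mathrm{des}(d,\sigma)$ is the number of $j\in[2n-1]$ with $\mathrm{can}(d,\sigma)_j>\mathrm{can}(d,\sigma)_{j+1}$. $C_d(t)=\sum_{\sigma\in\mathfrak{S}_n}t^{\mathrm{des}(d,\sigma)}$. $[t^i]f$ denotes the coefficient of $t^i$ in $f$. -}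

module Defs where

open import Data.Nat using (ℕ; zero; suc; _+_; _*_; _<ᵇ_; _≡ᵇ_)
open import Data.Bool using (Bool; true; false; _∧_; not; if_then_else_)
open import Data.List using (List; []; _∷_; length; map; concatMap; filterᵇ; upTo)
open import Data.Bool.ListAction using (any)
open import Relation.Binary.PropositionalEquality using (_≡_)

-- Steps of a lattice path: U = (1,1), D = (1,-1).
data Step : Set where
  U D : Step

dyckFrom : ℕ → List Step → Bool
dyckFrom zero    []      = true
dyckFrom (suc _) []      = false
dyckFrom h       (U ∷ s) = dyckFrom (suc h) s
dyckFrom zero    (D ∷ s) = false
dyckFrom (suc h) (D ∷ s) = dyckFrom h s

record IsDyck (n : ℕ) (d : List Step) : Set where
  field
    len   : length d ≡ n + n
    valid : dyckFrom 0 d ≡ true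

-- i-th entry (0-based) of a list of naturals (default 0, never used for valid inputs).
nth : List ℕ → ℕ → ℕ
nth []       _       = 0
nth (x ∷ xs) zero    = x
nth (x ∷ xs) (suc k) = nth xs k

-- can(d,σ): the k-th up-step and the k-th down-step both get label σ_k.
-- u, v count the up- and down-steps already read.
canFrom : List ℕ → ℕ → ℕ → List Step → List ℕ
canFrom σ u v []      = []
canFrom σ u v (U ∷ s) = nth σ u ∷ canFrom σ (suc u) v s
canFrom σ u v (D ∷ s) = nth σ v ∷ canFrom σ u (suc v) s

can : List Step → List ℕ → List ℕ
can d σ = canFrom σ 0 0 d

desWord : List ℕ → ℕ
desWord []           = 0
desWord (x ∷ [])     = 0
desWord (x ∷ y ∷ ws) = (if y <ᵇ x then 1 else 0) + desWord (y ∷ ws)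

des : List Step → List ℕ → ℕ
des d σ = desWord (can d σ)

words : ℕ → ℕ → List (List ℕ)
words n zero    = [] ∷ []
words n (suc k) = concatMap (λ a → map (a ∷_) (words n k)) (map suc (upTo n))

distinct : List ℕ → Bool
distinct []       = true
distinct (x ∷ xs) = not (any (_≡ᵇ x) xs) ∧ distinct xs

perms : ℕ → List (List ℕ)
perms n = filterᵇ distinct (words n n)

-- [t^i] C_d(t) for d of semilength n: the number of σ ∈ 𝔖_n with des(d,σ) = i
coeffC : ℕ → List Step → ℕ → ℕ
coeffC n d i = length (filterᵇ (λ σ → des d σ ≡ᵇ i) (perms n))

module Submission where

-- Let d = U U^j D rest, so that the letter σ₁ labels the first U and the first D, and let
-- d′ = U^j rest.  For σ = x ∷ τ we get can(d, σ) = x B x C with B C = can(d′, τ) and |B| = j;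
-- relabelling τ order-preservingly into [m] (unbump x) does not change des(d′, τ).
-- Inserting one letter into a word adds 0 or 1 descents, so des(d, σ) lies within 1 of
-- des(d′, τ′) + c, where c = 1 ⊓ j says whether B is nonempty.  Conversely every value
-- des(d′, σ′) + c is attained: put x = 1 in front of the shifted σ′ if B C has no descent at
-- the junction of B and C, and x = m + 1 if it has one.  So the attained descent numbers of d
-- contain a shift of those of d′ and lie within distance 1 of it; by induction they form an
-- interval.

open import Defs
open import Level using (0ℓ)
open import Data.Bool using (true; false; T; T?; not; if_then_else_)
open import Data.Bool.Properties using (T-∧)
open import Data.Bool.ListAction using (any)
open import Data.Empty using (⊥-elim)
open import Data.Nat
open import Data.Nat.Properties
open import Data.Nat.Tactic.RingSolver using (solve-∀)
open import Data.List using (List; []; _∷_; _++_; length; map; replicate; upTo; filterᵇ)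
open import Data.List.Properties using (length-map; length-replicate)
open import Data.List.Membership.Propositional using (_∈_; find; lose)
open import Data.List.Membership.Propositional.Properties
  using (∈-filter⁺; ∈-filter⁻; ∈-concatMap⁺; ∈-concatMap⁻; ∈-map⁺; ∈-map⁻; ∈-upTo⁺; ∈-upTo⁻)
open import Data.List.Relation.Unary.All as All using (All; []; _∷_)
import Data.List.Relation.Unary.All.Properties as All
open import Data.List.Relation.Unary.AllPairs using ([]; _∷_)
open import Data.List.Relation.Unary.Any using (here)
open import Data.List.Relation.Unary.Unique.Propositional using (Unique)
import Data.List.Relation.Unary.Unique.Propositional.Properties as Unique
open import Data.Product using (∃₂; ∃-syntax; _×_; _,_; proj₁; proj₂)
open import Data.Sum using (_⊎_; inj₁; inj₂)
open import Function.Base using (_∘_)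
open import Function.Bundles using (_⇔_; mk⇔; Equivalence)
open import Relation.Binary.Definitions using (tri<; tri≈; tri>)
open import Relation.Binary.PropositionalEquality
open import Relation.Nullary using (¬_; Dec; yes; no)
open import Relation.Nullary.Reflects using (ofʸ; ofⁿ)
open import Relation.Unary using (Pred; _⊆_)

-- Descents of words

descent : ℕ → ℕ → ℕ
descent a b = if b <ᵇ a then 1 else 0

descent-< : ∀ {a b} → b < a → descent a b ≡ 1
descent-< {a} {b} b<a with b <ᵇ a | <ᵇ-reflects-< b a
... | true  | _        = refl
... | false | ofⁿ b≮a = ⊥-elim (b≮a b<a)

descent-≤ : ∀ {a b} → a ≤ b → descent a b ≡ 0
descent-≤ {a} {b} a≤b with b <ᵇ a | <ᵇ-reflects-< b a
... | true  | ofʸ b<a = ⊥-elim (<⇒≱ b<a a≤b)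
... | false | _        = refl

descent-refl : ∀ a → descent a a ≡ 0
descent-refl a = descent-≤ (≤-refl {a})

descent-0or1 : ∀ a b → descent a b ≡ 0 ⊎ descent a b ≡ 1
descent-0or1 a b with b <ᵇ a
... | true  = inj₂ refl
... | false = inj₁ refl

descent≤1 : ∀ a b → descent a b ≤ 1
descent≤1 a b with b <ᵇ a
... | true  = ≤-refl
... | false = z≤n

descent-triangle : ∀ a b c → descent a c ≤ descent a b + descent b c
descent-triangle a b c with b <? a | c <? b
... | yes b<a | _ rewrite descent-< b<a = ≤-trans (descent≤1 a c) (m≤m+n 1 _)
... | no _    | yes c<b rewrite descent-< c<b = ≤-trans (descent≤1 a c) (m≤n+m 1 _)
... | no b≮a  | no c≮b rewrite descent-≤ (≤-trans (≮⇒≥ b≮a) (≮⇒≥ c≮b)) = z≤n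

descent-chain : ∀ a b c → descent a b + descent b c ≤ suc (descent a c)
descent-chain a b c with b <? a | c <? b
... | no b≮a  | _ rewrite descent-≤ (≮⇒≥ b≮a) = ≤-trans (descent≤1 b c) (s≤s z≤n)
... | yes b<a | no c≮b rewrite descent-< b<a | descent-≤ (≮⇒≥ c≮b) = s≤s z≤n
... | yes b<a | yes c<b rewrite descent-< b<a | descent-< c<b | descent-< (<-trans c<b b<a) = ≤-refl

StrictlyIncreasingOn : Pred ℕ 0ℓ → (ℕ → ℕ) → Set
StrictlyIncreasingOn P f = ∀ {a b} → P a → P b → a < b → f a < f b

descent-map : ∀ {P f} → StrictlyIncreasingOn P f → ∀ {a b} → P a → P b → descent (f a) (f b) ≡ descent a b
descent-map {f = f} incr {a} {b} pa pb with <-cmp a b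
... | tri< a<b _ _ = trans (descent-≤ (<⇒≤ (incr pa pb a<b))) (sym (descent-≤ (<⇒≤ a<b)))
... | tri≈ _ refl _ = trans (descent-refl (f a)) (sym (descent-refl a))
... | tri> _ _ b<a = trans (descent-< (incr pb pa b<a)) (sym (descent-< b<a))

desWord-map : ∀ {P f} → StrictlyIncreasingOn P f → ∀ {w} → All P w → desWord (map f w) ≡ desWord w
desWord-map incr []                  = refl
desWord-map incr (_ ∷ [])            = refl
desWord-map incr (pa ∷ ps@(pb ∷ _)) = cong₂ _+_ (descent-map incr pa pb) (desWord-map incr ps)

desWord-insert-≥ : ∀ x L M → desWord (L ++ M) ≤ desWord (L ++ x ∷ M)
desWord-insert-≥ x []          []      = z≤n
desWord-insert-≥ x []          (z ∷ M) = m≤n+m _ (descent x z)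
desWord-insert-≥ x (a ∷ [])    []      = z≤n
desWord-insert-≥ x (a ∷ [])    (z ∷ M) = begin
  descent a z + desWord (z ∷ M)                 ≤⟨ +-monoˡ-≤ _ (descent-triangle a x z) ⟩
  descent a x + descent x z + desWord (z ∷ M)   ≡⟨ +-assoc (descent a x) _ _ ⟩
  descent a x + (descent x z + desWord (z ∷ M)) ∎
  where open ≤-Reasoning
desWord-insert-≥ x (a ∷ b ∷ L) M       = +-monoʳ-≤ (descent a b) (desWord-insert-≥ x (b ∷ L) M)

desWord-insert-≤ : ∀ x L M → desWord (L ++ x ∷ M) ≤ suc (desWord (L ++ M))
desWord-insert-≤ x []          []      = z≤n
desWord-insert-≤ x []          (z ∷ M) = +-monoˡ-≤ _ (descent≤1 x z)
desWord-insert-≤ x (a ∷ [])    []      = ≤-trans (≤-reflexive (+-identityʳ _)) (descent≤1 a x)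
desWord-insert-≤ x (a ∷ [])    (z ∷ M) = begin
  descent a x + (descent x z + desWord (z ∷ M)) ≡⟨ +-assoc (descent a x) _ _ ⟨
  descent a x + descent x z + desWord (z ∷ M)   ≤⟨ +-monoˡ-≤ _ (descent-chain a x z) ⟩
  suc (descent a z + desWord (z ∷ M))           ∎
  where open ≤-Reasoning
desWord-insert-≤ x (a ∷ b ∷ L) M       =
  ≤-trans (+-monoʳ-≤ (descent a b) (desWord-insert-≤ x (b ∷ L) M)) (≤-reflexive (+-suc _ _))

Near : ℕ → ℕ → Set
Near a b = a ≤ suc b × b ≤ suc a

desWord-double-near : ∀ x B C → Near (desWord (x ∷ B ++ x ∷ C)) (1 ⊓ length B + desWord (B ++ C))
desWord-double-near x [] C rewrite descent-refl x =
  desWord-insert-≤ x [] C , ≤-trans (desWord-insert-≥ x [] C) (n≤1+n _)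
desWord-double-near x (b ∷ B) C =
  +-mono-≤ (descent≤1 x b) (desWord-insert-≤ x (b ∷ B) C) ,
  s≤s (≤-trans (desWord-insert-≥ x (b ∷ B) C) (m≤n+m _ (descent x b)))

junction : List ℕ → List ℕ → ℕ
junction []           _       = 0
junction (b ∷ [])     []      = 0
junction (b ∷ [])     (c ∷ _) = descent b c
junction (b ∷ b′ ∷ B) C       = junction (b′ ∷ B) C

junction-0or1 : ∀ B C → junction B C ≡ 0 ⊎ junction B C ≡ 1
junction-0or1 []           _       = inj₁ refl
junction-0or1 (b ∷ [])     []      = inj₁ refl
junction-0or1 (b ∷ [])     (c ∷ _) = descent-0or1 b c
junction-0or1 (b ∷ b′ ∷ B) C       = junction-0or1 (b′ ∷ B) C

junction-[]ʳ : ∀ B → junction B [] ≡ 0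
junction-[]ʳ []           = refl
junction-[]ʳ (b ∷ [])     = refl
junction-[]ʳ (b ∷ b′ ∷ B) = junction-[]ʳ (b′ ∷ B)

junction-map : ∀ {P f} → StrictlyIncreasingOn P f → ∀ {B C} → All P B → All P C →
  junction (map f B) (map f C) ≡ junction B C
junction-map incr []                  _         = refl
junction-map incr (_ ∷ [])            []        = refl
junction-map incr (pb ∷ [])           (pc ∷ _)  = descent-map incr pb pc
junction-map incr (_ ∷ pbs@(_ ∷ _))   pcs       = junction-map incr pbs pcs

desWord-++ : ∀ B C → desWord (B ++ C) ≡ desWord B + junction B C + desWord C
desWord-++ []           C       = refl
desWord-++ (b ∷ [])     []      = refl
desWord-++ (b ∷ [])     (c ∷ C) = refl
desWord-++ (b ∷ b′ ∷ B) C       = begin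
  descent b b′ + desWord (b′ ∷ B ++ C)
    ≡⟨ cong (descent b b′ +_) (desWord-++ (b′ ∷ B) C) ⟩
  descent b b′ + (desWord (b′ ∷ B) + junction (b′ ∷ B) C + desWord C)
    ≡⟨ +-assoc (descent b b′) _ _ ⟨
  descent b b′ + (desWord (b′ ∷ B) + junction (b′ ∷ B) C) + desWord C
    ≡⟨ cong (_+ desWord C) (+-assoc (descent b b′) _ _) ⟨
  descent b b′ + desWord (b′ ∷ B) + junction (b′ ∷ B) C + desWord C
    ∎
  where open ≡-Reasoning

desWord-∷-min : ∀ {x w} → All (x <_) w → desWord (x ∷ w) ≡ desWord w
desWord-∷-min []          = refl
desWord-∷-min (x<z ∷ _)   = cong (_+ _) (descent-≤ (<⇒≤ x<z))

desWord-∷-max : ∀ {x w} → All (_< x) w → desWord (x ∷ w) ≡ 1 ⊓ length w + desWord w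
desWord-∷-max []          = refl
desWord-∷-max (z<x ∷ _)   = cong (_+ _) (descent-< z<x)

junction-∷-min : ∀ {x B C} → All (x <_) B → junction (x ∷ B) (x ∷ C) ≡ 1 ⊓ length B
junction-∷-min {x} []                = descent-refl x
junction-∷-min (x<b ∷ [])            = descent-< x<b
junction-∷-min (_ ∷ x<B@(_ ∷ _))     = junction-∷-min x<B

junction-∷-max : ∀ {x B C} → All (_< x) B → junction (x ∷ B) (x ∷ C) ≡ 0
junction-∷-max {x} []                = descent-refl x
junction-∷-max (b<x ∷ [])            = descent-≤ (<⇒≤ b<x)
junction-∷-max (_ ∷ B<x@(_ ∷ _))     = junction-∷-max B<x

desWord-double-min : ∀ {x B C} → All (x <_) B → All (x <_) C → junction B C ≡ 0 →
  desWord (x ∷ B ++ x ∷ C) ≡ 1 ⊓ length B + desWord (B ++ C)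
desWord-double-min {x} {B} {C} x<B x<C J≡0 = begin
  desWord ((x ∷ B) ++ x ∷ C)
    ≡⟨ desWord-++ (x ∷ B) (x ∷ C) ⟩
  desWord (x ∷ B) + junction (x ∷ B) (x ∷ C) + desWord (x ∷ C)
    ≡⟨ cong₂ _+_ (cong₂ _+_ (desWord-∷-min x<B) (junction-∷-min x<B)) (desWord-∷-min x<C) ⟩
  desWord B + 1 ⊓ length B + desWord C
    ≡⟨ arith (desWord B) (1 ⊓ length B) (desWord C) ⟩
  1 ⊓ length B + (desWord B + 0 + desWord C)
    ≡⟨ cong (λ J → 1 ⊓ length B + (desWord B + J + desWord C)) J≡0 ⟨
  1 ⊓ length B + (desWord B + junction B C + desWord C)
    ≡⟨ cong (1 ⊓ length B +_) (desWord-++ B C) ⟨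
  1 ⊓ length B + desWord (B ++ C)
    ∎
  where
  open ≡-Reasoning
  arith : ∀ b n c → b + n + c ≡ n + (b + 0 + c)
  arith = solve-∀

desWord-double-max : ∀ {x B C} → All (_< x) B → All (_< x) C → junction B C ≡ 1 →
  desWord (x ∷ B ++ x ∷ C) ≡ 1 ⊓ length B + desWord (B ++ C)
desWord-double-max {x} {B} {[]}    _   _   J≡1 = ⊥-elim (0≢1+n (trans (sym (junction-[]ʳ B)) J≡1))
desWord-double-max {x} {B} {c ∷ C} B<x C<x J≡1 = begin
  desWord ((x ∷ B) ++ x ∷ c ∷ C)
    ≡⟨ desWord-++ (x ∷ B) (x ∷ c ∷ C) ⟩
  desWord (x ∷ B) + junction (x ∷ B) (x ∷ c ∷ C) + desWord (x ∷ c ∷ C)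
    ≡⟨ cong₂ _+_ (cong₂ _+_ (desWord-∷-max B<x) (junction-∷-max B<x)) (desWord-∷-max C<x) ⟩
  1 ⊓ length B + desWord B + 0 + (1 + desWord (c ∷ C))
    ≡⟨ arith (1 ⊓ length B) (desWord B) (desWord (c ∷ C)) ⟩
  1 ⊓ length B + (desWord B + 1 + desWord (c ∷ C))
    ≡⟨ cong (λ J → 1 ⊓ length B + (desWord B + J + desWord (c ∷ C))) J≡1 ⟨
  1 ⊓ length B + (desWord B + junction B (c ∷ C) + desWord (c ∷ C))
    ≡⟨ cong (1 ⊓ length B +_) (desWord-++ B (c ∷ C)) ⟨
  1 ⊓ length B + desWord (B ++ c ∷ C)
    ∎
  where
  open ≡-Reasoning
  arith : ∀ n b c → n + b + 0 + (1 + c) ≡ n + (b + 1 + c)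
  arith = solve-∀

-- Permutations

-- The order-preserving bijection from ℕ ∖ {x} onto ℕ; on [n+1] ∖ {x} it is the standardisation
-- onto [n].
unbump : ℕ → ℕ → ℕ
unbump x a = if x <ᵇ a then pred a else a

unbump-> : ∀ {x a} → x < a → unbump x a ≡ pred a
unbump-> {x} {a} x<a with x <ᵇ a | <ᵇ-reflects-< x a
... | true  | _        = refl
... | false | ofⁿ x≮a = ⊥-elim (x≮a x<a)

unbump-≤ : ∀ {x a} → a ≤ x → unbump x a ≡ a
unbump-≤ {x} {a} a≤x with x <ᵇ a | <ᵇ-reflects-< x a
... | true  | ofʸ x<a = ⊥-elim (<⇒≱ x<a a≤x)
... | false | _        = refl

unbump-increasing : ∀ {x} → StrictlyIncreasingOn (x ≢_) (unbump x)
unbump-increasing {x} {a} {b} x≢a _ a<b with x <? a | x <? b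
... | yes x<a | _ rewrite unbump-> x<a | unbump-> (<-trans x<a a<b) =
  pred-mono-< {{>-nonZero (≤-<-trans z≤n x<a)}} a<b
... | no x≮a | yes x<b rewrite unbump-≤ (≮⇒≥ x≮a) | unbump-> x<b =
  <-≤-trans (≤∧≢⇒< (≮⇒≥ x≮a) (x≢a ∘ sym)) (<⇒≤pred x<b)
... | no x≮a | no x≮b rewrite unbump-≤ (≮⇒≥ x≮a) | unbump-≤ (≮⇒≥ x≮b) = a<b

unbump-injective : ∀ {x a b} → x ≢ a → x ≢ b → unbump x a ≡ unbump x b → a ≡ b
unbump-injective {a = a} {b} x≢a x≢b eq with <-cmp a b
... | tri< a<b _ _ = ⊥-elim (<-irrefl eq (unbump-increasing x≢a x≢b a<b))
... | tri≈ _ a≡b _ = a≡b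
... | tri> _ _ b<a = ⊥-elim (<-irrefl (sym eq) (unbump-increasing x≢b x≢a b<a))

InRange : ℕ → ℕ → Set
InRange n a = 1 ≤ a × a ≤ n

unbump-inRange : ∀ {m x a} → InRange (suc m) x → InRange (suc m) a → x ≢ a → InRange m (unbump x a)
unbump-inRange {x = x} {a} (1≤x , x≤1+m) (1≤a , a≤1+m) x≢a with x <? a
... | yes x<a rewrite unbump-> x<a = <⇒≤pred (≤-<-trans 1≤x x<a) , pred-mono-≤ a≤1+m
... | no x≮a  rewrite unbump-≤ (≮⇒≥ x≮a) = 1≤a , ≤-pred (≤-trans (≤∧≢⇒< (≮⇒≥ x≮a) (x≢a ∘ sym)) x≤1+m)

record IsPerm (n : ℕ) (σ : List ℕ) : Set where
  constructor isPerm
  field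
    length≡ : length σ ≡ n
    inRange : All (InRange n) σ
    unique  : Unique σ

IsPerm-top : ∀ {m σ} → IsPerm m σ → IsPerm (suc m) (suc m ∷ σ)
IsPerm-top (isPerm len inRange unique) = isPerm
  (cong suc len)
  ((s≤s z≤n , ≤-refl) ∷ All.map (λ (1≤a , a≤m) → 1≤a , m≤n⇒m≤1+n a≤m) inRange)
  (All.map (λ (_ , a≤m) 1+m≡a → <⇒≢ (s≤s a≤m) (sym 1+m≡a)) inRange ∷ unique)

IsPerm-bottom : ∀ {m σ} → IsPerm m σ → IsPerm (suc m) (1 ∷ map suc σ)
IsPerm-bottom {σ = σ} (isPerm len inRange unique) = isPerm
  (cong suc (trans (length-map suc σ) len))
  ((≤-refl , s≤s z≤n) ∷ All.map⁺ (All.map (λ (_ , a≤m) → s≤s z≤n , s≤s a≤m) inRange))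
  (All.map⁺ (All.map (λ (1≤a , _) 1≡1+a → <⇒≢ 1≤a (suc-injective 1≡1+a)) inRange) ∷
   Unique.map⁺ suc-injective unique)

IsPerm-unbump : ∀ {m x τ} → IsPerm (suc m) (x ∷ τ) → IsPerm m (map (unbump x) τ)
IsPerm-unbump {x = x} {τ} (isPerm len (x∈ ∷ τ∈) (x∉τ ∷ τ!)) = isPerm
  (trans (length-map (unbump x) τ) (suc-injective len))
  (All.map⁺ (All.zipWith (λ (a∈ , x≢a) → unbump-inRange x∈ a∈ x≢a) (τ∈ , x∉τ)))
  (unbump-unique x∉τ τ!)
  where
  unbump-unique : ∀ {w} → All (x ≢_) w → Unique w → Unique (map (unbump x) w)
  unbump-unique []           []           = []
  unbump-unique (x≢a ∷ x∉w) (a∉w ∷ w!) =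
    All.map⁺ (All.zipWith (λ (a≢b , x≢b) → a≢b ∘ unbump-injective x≢a x≢b) (a∉w , x∉w)) ∷
    unbump-unique x∉w w!

∈-words⁺ : ∀ {n} k {σ} → length σ ≡ k → All (InRange n) σ → σ ∈ words n k
∈-words⁺ zero    {[]}    _   _                        = here refl
∈-words⁺ {n} (suc k) {a ∷ τ} len ((s≤s z≤n , a≤n) ∷ τ∈) =
  ∈-concatMap⁺ (λ b → map (b ∷_) (words n k)) (lose (∈-map⁺ suc (∈-upTo⁺ a≤n)) (∈-map⁺ (a ∷_) (∈-words⁺ k (suc-injective len) τ∈)))

∈-words⁻ : ∀ {n} k {σ} → σ ∈ words n k → length σ ≡ k × All (InRange n) σ
∈-words⁻ zero    (here refl) = refl , []
∈-words⁻ {n} (suc k) σ∈ with find (∈-concatMap⁻ (λ b → map (b ∷_) (words n k)) {xs = map suc (upTo n)} σ∈)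
... | a , a∈ , σ∈a with ∈-map⁻ suc a∈ | ∈-map⁻ (a ∷_) σ∈a
... | a′ , a′∈ , refl | τ , τ∈ , refl with ∈-words⁻ k τ∈
... | len , τ∈range = cong suc len , (s≤s z≤n , ∈-upTo⁻ a′∈) ∷ τ∈range

fresh⇒All≢ : ∀ {x} xs → T (not (any (_≡ᵇ x) xs)) → All (x ≢_) xs
fresh⇒All≢     []       _     = []
fresh⇒All≢ {x} (y ∷ ys) fresh with y ≡ᵇ x in y≡ᵇx
... | false = (λ x≡y → subst T y≡ᵇx (≡⇒≡ᵇ y x (sym x≡y))) ∷ fresh⇒All≢ ys fresh

All≢⇒fresh : ∀ {x xs} → All (x ≢_) xs → T (not (any (_≡ᵇ x) xs))
All≢⇒fresh         []           = _
All≢⇒fresh {x} {y ∷ _} (x≢y ∷ x∉ys) with y ≡ᵇ x in y≡ᵇx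
... | true  = x≢y (sym (≡ᵇ⇒≡ y x (subst T (sym y≡ᵇx) _)))
... | false = All≢⇒fresh x∉ys

distinct⇒Unique : ∀ σ → T (distinct σ) → Unique σ
distinct⇒Unique []       _  = []
distinct⇒Unique (x ∷ xs) dx with Equivalence.to T-∧ dx
... | fresh , dxs = fresh⇒All≢ xs fresh ∷ distinct⇒Unique xs dxs

Unique⇒distinct : ∀ {σ} → Unique σ → T (distinct σ)
Unique⇒distinct []             = _
Unique⇒distinct (x∉xs ∷ xs!) = Equivalence.from T-∧ (All≢⇒fresh x∉xs , Unique⇒distinct xs!)

∈-perms⇔ : ∀ {n σ} → σ ∈ perms n ⇔ IsPerm n σ
∈-perms⇔ {n} {σ} = mk⇔ sound complete
  where
  sound : σ ∈ perms n → IsPerm n σ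
  sound σ∈ with ∈-filter⁻ (T? ∘ distinct) σ∈
  ... | σ∈words , dσ with ∈-words⁻ n σ∈words
  ... | len , inRange = isPerm len inRange (distinct⇒Unique σ dσ)
  complete : IsPerm n σ → σ ∈ perms n
  complete (isPerm len inRange unique) =
    ∈-filter⁺ (T? ∘ distinct) (∈-words⁺ n len inRange) (Unique⇒distinct unique)

-- Dyck paths and their canonical words

ups downs : List Step → ℕ
ups []      = 0
ups (U ∷ s) = suc (ups s)
ups (D ∷ s) = ups s
downs []      = 0
downs (U ∷ s) = downs s
downs (D ∷ s) = suc (downs s)

length≡ups+downs : ∀ s → length s ≡ ups s + downs s
length≡ups+downs []      = refl
length≡ups+downs (U ∷ s) = cong suc (length≡ups+downs s)
length≡ups+downs (D ∷ s) = trans (cong suc (length≡ups+downs s)) (sym (+-suc (ups s) (downs s)))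

dyckFrom-U : ∀ h s → dyckFrom h (U ∷ s) ≡ dyckFrom (suc h) s
dyckFrom-U zero    s = refl
dyckFrom-U (suc h) s = refl

dyckFrom-balance : ∀ h s → dyckFrom h s ≡ true → h + ups s ≡ downs s
dyckFrom-balance zero    []      _     = refl
dyckFrom-balance h       (U ∷ s) valid =
  trans (+-suc h (ups s)) (dyckFrom-balance (suc h) s (trans (sym (dyckFrom-U h s)) valid))
dyckFrom-balance (suc h) (D ∷ s) valid = cong suc (dyckFrom-balance h s valid)

double-injective : ∀ {a b} → a + a ≡ b + b → a ≡ b
double-injective {a} {b} eq with <-cmp a b
... | tri< a<b _ _ = ⊥-elim (<-irrefl eq (+-mono-< a<b a<b))
... | tri≈ _ a≡b _ = a≡b
... | tri> _ _ b<a = ⊥-elim (<-irrefl (sym eq) (+-mono-< b<a b<a))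

IsDyck-ups : ∀ {n d} → IsDyck n d → ups d ≡ n
IsDyck-ups {n} {d} isDyck = double-injective (begin
  ups d + ups d   ≡⟨ cong (ups d +_) (dyckFrom-balance 0 d (IsDyck.valid isDyck)) ⟩
  ups d + downs d ≡⟨ length≡ups+downs d ⟨
  length d        ≡⟨ IsDyck.len isDyck ⟩
  n + n           ∎)
  where open ≡-Reasoning

IsDyck-downs : ∀ {n d} → IsDyck n d → downs d ≡ n
IsDyck-downs {d = d} isDyck = trans (sym (dyckFrom-balance 0 d (IsDyck.valid isDyck))) (IsDyck-ups isDyck)

dyckFrom-firstDown : ∀ h s → dyckFrom (suc h) s ≡ true →
  ∃₂ λ j rest → s ≡ replicate j U ++ D ∷ rest × dyckFrom h (replicate j U ++ rest) ≡ true
dyckFrom-firstDown h (U ∷ s) valid with dyckFrom-firstDown (suc h) s valid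
... | j , rest , refl , valid′ = suc j , rest , refl , trans (dyckFrom-U h _) valid′
dyckFrom-firstDown h (D ∷ rest) valid = 0 , rest , refl , valid

length-++-∷ : ∀ {A : Set} (xs : List A) {y ys} → length (xs ++ y ∷ ys) ≡ suc (length (xs ++ ys))
length-++-∷ []       = refl
length-++-∷ (_ ∷ xs) = cong suc (length-++-∷ xs)

IsDyck-firstPeak : ∀ {m d} → IsDyck (suc m) d →
  ∃₂ λ j rest → d ≡ U ∷ replicate j U ++ D ∷ rest × IsDyck m (replicate j U ++ rest)
IsDyck-firstPeak {m} {U ∷ s} isDyck with dyckFrom-firstDown 0 s (IsDyck.valid isDyck)
... | j , rest , refl , valid′ = j , rest , refl , record { len = len′ ; valid = valid′ }
  where
  len′ : length (replicate j U ++ rest) ≡ m + m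
  len′ = suc-injective (suc-injective (begin
    suc (suc (length (replicate j U ++ rest))) ≡⟨ cong suc (length-++-∷ (replicate j U)) ⟨
    length (U ∷ replicate j U ++ D ∷ rest)     ≡⟨ IsDyck.len isDyck ⟩
    suc m + suc m                              ≡⟨ cong suc (+-suc m m) ⟩
    suc (suc (m + m))                          ∎))
    where open ≡-Reasoning
IsDyck-firstPeak {d = []}    record { len = () }
IsDyck-firstPeak {d = D ∷ _} record { valid = () }

nth-All : ∀ {P : Pred ℕ 0ℓ} {σ} i → All P σ → i < length σ → P (nth σ i)
nth-All zero    (pa ∷ _)  _        = pa
nth-All (suc i) (_ ∷ pσ) (s≤s i<) = nth-All i pσ i<

canFrom-All : ∀ {P : Pred ℕ 0ℓ} {σ} u v s → All P σ →
  u + ups s ≤ length σ → v + downs s ≤ length σ → All P (canFrom σ u v s)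
canFrom-All u v []      _  _   _   = []
canFrom-All u v (U ∷ s) pσ uOK vOK =
  nth-All u pσ (≤-trans (s≤s (m≤m+n u (ups s))) uOK′) ∷ canFrom-All (suc u) v s pσ uOK′ vOK
  where
  uOK′ : suc u + ups s ≤ _
  uOK′ = ≤-trans (≤-reflexive (sym (+-suc u (ups s)))) uOK
canFrom-All u v (D ∷ s) pσ uOK vOK =
  nth-All v pσ (≤-trans (s≤s (m≤m+n v (downs s))) vOK′) ∷ canFrom-All u (suc v) s pσ uOK vOK′
  where
  vOK′ : suc v + downs s ≤ _
  vOK′ = ≤-trans (≤-reflexive (sym (+-suc v (downs s)))) vOK

can-All : ∀ {P : Pred ℕ 0ℓ} {n d σ} → IsDyck n d → length σ ≡ n → All P σ → All P (can d σ)
can-All {d = d} isDyck len pσ = canFrom-All 0 0 d pσ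
  (≤-reflexive (trans (IsDyck-ups isDyck) (sym len)))
  (≤-reflexive (trans (IsDyck-downs isDyck) (sym len)))

-- f 0 ≡ 0 is needed because nth returns 0 out of range.
nth-map : ∀ (f : ℕ → ℕ) → f 0 ≡ 0 → ∀ σ i → nth (map f σ) i ≡ f (nth σ i)
nth-map f f0≡0 []      _       = sym f0≡0
nth-map f f0≡0 (_ ∷ _) zero    = refl
nth-map f f0≡0 (_ ∷ σ) (suc i) = nth-map f f0≡0 σ i

canFrom-map : ∀ (f : ℕ → ℕ) → f 0 ≡ 0 → ∀ σ u v s → canFrom (map f σ) u v s ≡ map f (canFrom σ u v s)
canFrom-map f f0≡0 σ u v []      = refl
canFrom-map f f0≡0 σ u v (U ∷ s) = cong₂ _∷_ (nth-map f f0≡0 σ u) (canFrom-map f f0≡0 σ (suc u) v s)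
canFrom-map f f0≡0 σ u v (D ∷ s) = cong₂ _∷_ (nth-map f f0≡0 σ v) (canFrom-map f f0≡0 σ u (suc v) s)

length-canFrom : ∀ σ u v s → length (canFrom σ u v s) ≡ length s
length-canFrom σ u v []      = refl
length-canFrom σ u v (U ∷ s) = cong suc (length-canFrom σ (suc u) v s)
length-canFrom σ u v (D ∷ s) = cong suc (length-canFrom σ u (suc v) s)

canFrom-∷ : ∀ x σ u v s → canFrom (x ∷ σ) (suc u) (suc v) s ≡ canFrom σ u v s
canFrom-∷ x σ u v []      = refl
canFrom-∷ x σ u v (U ∷ s) = cong (nth σ u ∷_) (canFrom-∷ x σ (suc u) v s)
canFrom-∷ x σ u v (D ∷ s) = cong (nth σ v ∷_) (canFrom-∷ x σ u (suc v) s)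

canFrom-ups-∷ : ∀ x σ u v j → canFrom (x ∷ σ) (suc u) v (replicate j U) ≡ canFrom σ u v (replicate j U)
canFrom-ups-∷ x σ u v zero    = refl
canFrom-ups-∷ x σ u v (suc j) = cong (nth σ u ∷_) (canFrom-ups-∷ x σ (suc u) v j)

canFrom-ups-++ : ∀ σ u v j t →
  canFrom σ u v (replicate j U ++ t) ≡ canFrom σ u v (replicate j U) ++ canFrom σ (u + j) v t
canFrom-ups-++ σ u v zero    t = cong (λ k → canFrom σ k v t) (sym (+-identityʳ u))
canFrom-ups-++ σ u v (suc j) t = cong (nth σ u ∷_) (trans (canFrom-ups-++ σ (suc u) v j t)
  (cong (λ k → canFrom σ (suc u) v (replicate j U) ++ canFrom σ k v t) (sym (+-suc u j))))

map-unbump-suc : ∀ {σ} → All (1 ≤_) σ → map (unbump 1) (map suc σ) ≡ σ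
map-unbump-suc []            = refl
map-unbump-suc (s≤s z≤n ∷ p) = cong (_ ∷_) (map-unbump-suc p)

des-unbump : ∀ {n d x τ} → IsDyck n d → length τ ≡ n → All (x ≢_) τ →
  des d (map (unbump x) τ) ≡ des d τ
des-unbump {d = d} {x} {τ} isDyck len x∉τ =
  trans (cong desWord (canFrom-map (unbump x) refl τ 0 0 d)) (desWord-map unbump-increasing (can-All isDyck len x∉τ))

-- Attained descent numbers form an interval

Convex : Pred ℕ 0ℓ → Set
Convex P = ∀ {i j k} → i ≤ j → j ≤ k → P i → P k → P j

Shift : ℕ → Pred ℕ 0ℓ → Pred ℕ 0ℓ
Shift c Q j = ∃[ i ] Q i × c + i ≡ j

convex-shift : ∀ {Q} c → Convex Q → Convex (Shift c Q)
convex-shift c convexQ {j = j} c+i≤j j≤c+k (i , Qi , refl) (k , Qk , refl) =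
  j ∸ c ,
  convexQ (m+n≤o⇒m≤o∸n i (≤-trans (≤-reflexive (+-comm i c)) c+i≤j)) (m≤n+o⇒m∸n≤o j c j≤c+k) Qi Qk ,
  m+[n∸m]≡n (≤-trans (m≤m+n c i) c+i≤j)

convex-near : ∀ {P Q : Pred ℕ 0ℓ} → Convex Q → Q ⊆ P → (∀ {i} → P i → ∃[ i′ ] Q i′ × Near i i′) → Convex P
convex-near {P} convexQ Q⊆P near {i} {j} {k} i≤j j≤k Pi Pk with near Pi | near Pk
... | i′ , Qi′ , _ , i′≤1+i | k′ , Qk′ , k≤1+k′ , _ with i′ ≤? j | j ≤? k′
...   | no i′≰j  | _          = subst P (≤-antisym i≤j (≤-pred (≤-trans (≰⇒> i′≰j) i′≤1+i))) Pi
...   | yes _    | no j≰k′    = subst P (≤-antisym (≤-trans k≤1+k′ (≰⇒> j≰k′)) j≤k) Pk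
...   | yes i′≤j | yes j≤k′   = Q⊆P (convexQ i′≤j j≤k′ Qi′ Qk′)

Attained : ℕ → List Step → Pred ℕ 0ℓ
Attained n d i = ∃[ σ ] IsPerm n σ × des d σ ≡ i

module FirstPeak (j : ℕ) (rest : List Step) where

  path path′ : List Step
  path  = U ∷ replicate j U ++ D ∷ rest
  path′ = replicate j U ++ rest

  front back : List ℕ → List ℕ
  front τ = canFrom τ 0 0 (replicate j U)
  back  τ = canFrom τ j 0 rest

  can-path′ : ∀ τ → can path′ τ ≡ front τ ++ back τ
  can-path′ τ = canFrom-ups-++ τ 0 0 j rest

  des-path : ∀ x τ → des path (x ∷ τ) ≡ desWord (x ∷ front τ ++ x ∷ back τ)
  des-path x τ = cong (λ w → desWord (x ∷ w)) (begin
    canFrom (x ∷ τ) 1 0 (replicate j U ++ D ∷ rest)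
      ≡⟨ canFrom-ups-++ (x ∷ τ) 1 0 j (D ∷ rest) ⟩
    canFrom (x ∷ τ) 1 0 (replicate j U) ++ x ∷ canFrom (x ∷ τ) (suc j) 1 rest
      ≡⟨ cong₂ (λ B C → B ++ x ∷ C) (canFrom-ups-∷ x τ 0 0 j) (canFrom-∷ x τ j 0 rest) ⟩
    front τ ++ x ∷ back τ
      ∎)
    where open ≡-Reasoning

  des-path′ : ∀ τ → des path′ τ ≡ desWord (front τ ++ back τ)
  des-path′ τ = cong desWord (can-path′ τ)

  length-front : ∀ τ → length (front τ) ≡ j
  length-front τ = trans (length-canFrom τ 0 0 (replicate j U)) (length-replicate j)

  module _ {m} (isDyck′ : IsDyck m path′) where

    front-All : ∀ {P : Pred ℕ 0ℓ} {τ} → length τ ≡ m → All P τ → All P (front τ)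
    front-All {τ = τ} len pτ = All.++⁻ˡ (front τ) (subst (All _) (can-path′ τ) (can-All isDyck′ len pτ))

    back-All : ∀ {P : Pred ℕ 0ℓ} {τ} → length τ ≡ m → All P τ → All P (back τ)
    back-All {τ = τ} len pτ = All.++⁻ʳ (front τ) (subst (All _) (can-path′ τ) (can-All isDyck′ len pτ))

    junction-unbump : ∀ {x τ} → length τ ≡ m → All (x ≢_) τ →
      junction (front (map (unbump x) τ)) (back (map (unbump x) τ)) ≡ junction (front τ) (back τ)
    junction-unbump {x} {τ} len x∉τ = trans
      (cong₂ junction (canFrom-map (unbump x) refl τ 0 0 (replicate j U)) (canFrom-map (unbump x) refl τ j 0 rest))
      (junction-map unbump-increasing (front-All len x∉τ) (back-All len x∉τ))

    restrict : ∀ {i} → Attained (suc m) path i → ∃[ i′ ] Shift (1 ⊓ j) (Attained m path′) i′ × Near i i′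
    restrict ([] , isPerm () _ _ , _)
    restrict (x ∷ τ , p@(isPerm len _ (x∉τ ∷ _)) , refl) =
      1 ⊓ j + des path′ τ′ , (des path′ τ′ , (τ′ , IsPerm-unbump p , refl) , refl) ,
      subst₂ Near (sym (des-path x τ)) shifted (desWord-double-near x (front τ) (back τ))
      where
      τ′ : List ℕ
      τ′ = map (unbump x) τ
      shifted : 1 ⊓ length (front τ) + desWord (front τ ++ back τ) ≡ 1 ⊓ j + des path′ τ′
      shifted = cong₂ (λ ℓ w → 1 ⊓ ℓ + w) (length-front τ)
        (trans (sym (des-path′ τ)) (sym (des-unbump isDyck′ (suc-injective len) x∉τ)))

    des-top : ∀ {σ′} → IsPerm m σ′ → junction (front σ′) (back σ′) ≡ 1 →
      des path (suc m ∷ σ′) ≡ 1 ⊓ j + des path′ σ′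
    des-top {σ′} (isPerm len inRange _) J≡1 = begin
      des path (suc m ∷ σ′)
        ≡⟨ des-path (suc m) σ′ ⟩
      desWord (suc m ∷ front σ′ ++ suc m ∷ back σ′)
        ≡⟨ desWord-double-max (front-All len σ′<top) (back-All len σ′<top) J≡1 ⟩
      1 ⊓ length (front σ′) + desWord (front σ′ ++ back σ′)
        ≡⟨ cong₂ (λ ℓ w → 1 ⊓ ℓ + w) (length-front σ′) (sym (des-path′ σ′)) ⟩
      1 ⊓ j + des path′ σ′
        ∎
      where
      open ≡-Reasoning
      σ′<top : All (_< suc m) σ′
      σ′<top = All.map (s≤s ∘ proj₂) inRange

    des-bottom : ∀ {σ′} → IsPerm m σ′ → junction (front σ′) (back σ′) ≡ 0 →
      des path (1 ∷ map suc σ′) ≡ 1 ⊓ j + des path′ σ′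
    des-bottom {σ′} (isPerm len inRange _) J≡0 = begin
      des path (1 ∷ τ)
        ≡⟨ des-path 1 τ ⟩
      desWord (1 ∷ front τ ++ 1 ∷ back τ)
        ≡⟨ desWord-double-min (front-All lenτ 1<τ) (back-All lenτ 1<τ) Jτ≡0 ⟩
      1 ⊓ length (front τ) + desWord (front τ ++ back τ)
        ≡⟨ cong₂ (λ ℓ w → 1 ⊓ ℓ + w) (length-front τ) (sym (des-path′ τ)) ⟩
      1 ⊓ j + des path′ τ
        ≡⟨ cong (1 ⊓ j +_) (des-unbump isDyck′ lenτ 1∉τ) ⟨
      1 ⊓ j + des path′ (map (unbump 1) τ)
        ≡⟨ cong (λ σ → 1 ⊓ j + des path′ σ) σ′≡ ⟩
      1 ⊓ j + des path′ σ′
        ∎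
      where
      open ≡-Reasoning
      τ : List ℕ
      τ = map suc σ′
      lenτ : length τ ≡ m
      lenτ = trans (length-map suc σ′) len
      1<τ : All (1 <_) τ
      1<τ = All.map⁺ (All.map (s≤s ∘ proj₁) inRange)
      1∉τ : All (1 ≢_) τ
      1∉τ = All.map <⇒≢ 1<τ
      σ′≡ : map (unbump 1) τ ≡ σ′
      σ′≡ = map-unbump-suc (All.map proj₁ inRange)
      Jτ≡0 : junction (front τ) (back τ) ≡ 0
      Jτ≡0 = trans (sym (junction-unbump lenτ 1∉τ))
        (subst (λ σ → junction (front σ) (back σ) ≡ 0) (sym σ′≡) J≡0)

    extend : Shift (1 ⊓ j) (Attained m path′) ⊆ Attained (suc m) path
    extend (_ , (σ′ , p , refl) , refl) with junction-0or1 (front σ′) (back σ′)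
    ... | inj₁ J≡0 = 1 ∷ map suc σ′ , IsPerm-bottom p , des-bottom p J≡0
    ... | inj₂ J≡1 = suc m ∷ σ′ , IsPerm-top p , des-top p J≡1

attained-convex : ∀ {n d} → IsDyck n d → Convex (Attained n d)
attained-convex {zero} {[]} _ _ j≤k (σ , p , refl) (_ , _ , refl) = σ , p , sym (n≤0⇒n≡0 j≤k)
attained-convex {zero} {_ ∷ _} record { len = () }
attained-convex {suc m} isDyck with IsDyck-firstPeak isDyck
... | j , rest , refl , isDyck′ =
  convex-near (convex-shift (1 ⊓ j) (attained-convex isDyck′)) (extend isDyck′) (restrict isDyck′)
  where open FirstPeak j rest

∈⇒length≢0 : ∀ {A : Set} {x : A} {xs} → x ∈ xs → length xs ≢ 0
∈⇒length≢0 {xs = _ ∷ _} _ ()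

length≢0⇒∈ : ∀ {A : Set} {xs : List A} → length xs ≢ 0 → ∃[ x ] x ∈ xs
length≢0⇒∈ {xs = []}    len≢0 = ⊥-elim (len≢0 refl)
length≢0⇒∈ {xs = x ∷ _} _     = x , here refl

coeffC≢0⇔Attained : ∀ n d {i} → coeffC n d i ≢ 0 ⇔ Attained n d i
coeffC≢0⇔Attained n d {i} = mk⇔ attained coeffC≢0
  where
  hasDes? : ∀ σ → Dec (T (des d σ ≡ᵇ i))
  hasDes? σ = T? (des d σ ≡ᵇ i)
  attained : coeffC n d i ≢ 0 → Attained n d i
  attained c≢0 with length≢0⇒∈ c≢0
  ... | σ , σ∈ with ∈-filter⁻ hasDes? σ∈
  ...   | σ∈perms , desσ = σ , Equivalence.to ∈-perms⇔ σ∈perms , ≡ᵇ⇒≡ _ _ desσ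
  coeffC≢0 : Attained n d i → coeffC n d i ≢ 0
  coeffC≢0 (σ , p , refl) =
    ∈⇒length≢0 (∈-filter⁺ hasDes? (Equivalence.from ∈-perms⇔ p) (≡⇒≡ᵇ (des d σ) _ refl))

proposition4p7 : (n : ℕ) (d : List Step) → IsDyck n d →
    ¬ (∃[ i ] ∃[ j ] ∃[ k ] (i < j × j < k × coeffC n d i ≢ 0 × coeffC n d k ≢ 0 × coeffC n d j ≡ 0))
proposition4p7 n d isDyck (i , j , k , i<j , j<k , cᵢ≢0 , cₖ≢0 , cⱼ≡0) =
  Equivalence.from (coeffC≢0⇔Attained n d)
    (attained-convex isDyck (<⇒≤ i<j) (<⇒≤ j<k) (attained cᵢ≢0) (attained cₖ≢0))
    cⱼ≡0
  where
  attained : ∀ {i} → coeffC n d i ≢ 0 → Attained n d i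
  attained = Equivalence.to (coeffC≢0⇔Attained n d)
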